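{- Let $A \in \mathbb{Z}^{3 \times 3}$. We have $\mathrm{bal}(A) \le 2$ if and only if (1) $\mathrm{rank}(\Theta(A)) < 3$; and (2) the row sums, column sums, and diagonal entries of $A$ are ternary triples.
   Context: For $A \in \mathbb{Z}^{n \times n}$ and a permutation $\sigma \in \mathcal{S}_n$, let $A^\sigma$ be the matrix with entries $(A^\sigma)_{ij} = A_{\sigma(i),\sigma(j)}$. The balancing index $\mathrm{bal}(A)$ is the least positive value of $\sum_{\sigma \in \mathcal{S}_n} c_\sigma$ over integer coefficients $(c_\sigma)$ such that $\sum_{\sigma} c_\sigma A^\sigma \in \langle I,J\rangle := \{aI+bJ : a,b \in \mathbb{Z}\}$ (here $I$ is the identity and $J$ the all-ones matrix). For $A \in \mathbb{Z}^{3\times 3}$, let $d_i^+$ and $d_j^-$ denote the $i$th row sum and $j$th column sum of $A$ (including diagonal entries), and define the $4 \times 3$ matrix $\Theta(A)$ whose rows are $(1,1,1)$, $(A_{11},A_{22},A_{33})$, $(d_1^+,d_2^+,d_3^+)$, $(d_1^-,d_2^-,d_3^-)$. A triple of integers $(a,b,c)$ is a ternary triple if there exist integers $x,y,z$ with $x+y+z=1$ and $ax+by+cz = \frac{1}{3}(a+b+c)$; equivalently, $\nu_3(a+b-2c) \ge 1+\min(\nu_3(a-c),\nu_3(b-c))$, where $\nu_3$ is the $3$-adic valuation (with $\nu_3(0)=\infty$). -}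

module Defs where

open import Data.Nat using (ℕ)
open import Data.Fin using (Fin; zero; suc)
open import Data.Integer using (ℤ; _+_; _*_; _<_; _≤_; +_; 0ℤ; 1ℤ)
open import Data.Product using (Σ; ∃; _×_; _,_)
open import Relation.Binary.PropositionalEquality using (_≡_; _≢_)

Mat : ℕ → ℕ → Set
Mat m n = Fin m → Fin n → ℤ

pattern 𝟎 = zero
pattern 𝟏 = suc zero
pattern 𝟐 = suc (suc zero)

Σ3 : (Fin 3 → ℤ) → ℤ
Σ3 f = f 𝟎 + f 𝟏 + f 𝟐

Σ6 : (Fin 6 → ℤ) → ℤ
Σ6 f = f zero + f (suc zero) + f (suc (suc zero)) + f (suc (suc (suc zero)))
     + f (suc (suc (suc (suc zero)))) + f (suc (suc (suc (suc (suc zero)))))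

-- The six elements of S₃, given as maps Fin 3 → Fin 3 (by their value tables).
σ : Fin 6 → Fin 3 → Fin 3
σ zero i = i
σ (suc zero) 𝟎 = 𝟏
σ (suc zero) 𝟏 = 𝟎
σ (suc zero) 𝟐 = 𝟐
σ (suc (suc zero)) 𝟎 = 𝟐
σ (suc (suc zero)) 𝟏 = 𝟏
σ (suc (suc zero)) 𝟐 = 𝟎
σ (suc (suc (suc zero))) 𝟎 = 𝟎
σ (suc (suc (suc zero))) 𝟏 = 𝟐
σ (suc (suc (suc zero))) 𝟐 = 𝟏
σ (suc (suc (suc (suc zero)))) 𝟎 = 𝟏
σ (suc (suc (suc (suc zero)))) 𝟏 = 𝟐
σ (suc (suc (suc (suc zero)))) 𝟐 = 𝟎
σ (suc (suc (suc (suc (suc zero))))) 𝟎 = 𝟐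
σ (suc (suc (suc (suc (suc zero))))) 𝟏 = 𝟎
σ (suc (suc (suc (suc (suc zero))))) 𝟐 = 𝟏

permMat : Mat 3 3 → (Fin 3 → Fin 3) → Mat 3 3
permMat A s i j = A (s i) (s j)

δ : {n : ℕ} → Fin n → Fin n → ℤ
δ zero zero = 1ℤ
δ zero (suc j) = 0ℤ
δ (suc i) zero = 0ℤ
δ (suc i) (suc j) = δ i j

InIJ : Mat 3 3 → Set
InIJ M = Σ ℤ λ a → Σ ℤ λ b → ∀ i j → M i j ≡ a * δ i j + b

combo : Mat 3 3 → (Fin 6 → ℤ) → Mat 3 3
combo A c i j = Σ6 (λ k → c k * permMat A (σ k) i j)

-- "bal(A) ≤ k": the least positive value of Σ c_σ over balancing
-- coefficient vectors is ≤ k, i.e. some balancing vector has 0 < Σ c_σ ≤ k.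
BalLe : Mat 3 3 → ℤ → Set
BalLe A k = Σ (Fin 6 → ℤ) λ c → (0ℤ < Σ6 c) × (Σ6 c ≤ k) × InIJ (combo A c)

-- row sums d⁺ and column sums d⁻ (including diagonal entries)
rowSum : Mat 3 3 → Fin 3 → ℤ
rowSum A i = Σ3 (λ j → A i j)

colSum : Mat 3 3 → Fin 3 → ℤ
colSum A j = Σ3 (λ i → A i j)

diag : Mat 3 3 → Fin 3 → ℤ
diag A i = A i i

Θ : Mat 3 3 → Mat 4 3
Θ A zero j = 1ℤ
Θ A (suc zero) j = diag A j
Θ A (suc (suc zero)) j = rowSum A j
Θ A (suc (suc (suc zero))) j = colSum A j

-- rank of a 4×3 matrix is < 3 iff its 3 columns are linearly dependent
-- (over ℚ, equivalently over ℤ by clearing denominators).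
RankLt3 : Mat 4 3 → Set
RankLt3 M = Σ (Fin 3 → ℤ) λ v → (∃ λ j → v j ≢ 0ℤ) × (∀ i → Σ3 (λ j → M i j * v j) ≡ 0ℤ)

-- (a,b,c) ternary: ∃ x y z ∈ ℤ, x+y+z = 1 and a x + b y + c z = (a+b+c)/3
-- (the latter written multiplied by 3 to stay in ℤ).
Ternary : ℤ → ℤ → ℤ → Set
Ternary a b c = Σ ℤ λ x → Σ ℤ λ y → Σ ℤ λ z →
  (x + y + z ≡ 1ℤ) × (+ 3 * (a * x + b * y + c * z) ≡ a + b + c)

TernaryVec : (Fin 3 → ℤ) → Set
TernaryVec t = Ternary (t 𝟎) (t 𝟏) (t 𝟐)

-- Write E = Σ_σ c_σ A^σ and P = Σ_σ c_σ P_σ, where (P_σ)ᵢⱼ = [σ(i) = j]. The diagonal, the row sums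
-- and the column sums of E are P applied to those of A, so E ∈ ⟨I,J⟩ forces P t to be constant for
-- every row t of Θ(A). When Σ c_σ ∈ {1,2}, a difference of two rows of P is then a kernel vector of
-- Θ(A); it is nonzero because every column of P sums to Σ c_σ, which is not divisible by 3. The first
-- row q of P (or 1 - q) is a ternary witness for each row of Θ(A).
--
-- Conversely, q is a ternary witness for t exactly when 3q - 1 is orthogonal to 1 and t. If 1, t, s
-- are all orthogonal to some v ≠ 0 and t is not constant, then 1 and t span their common plane, so
-- every witness for t is one for s; hence rank Θ(A) < 3 gives a common witness q. The coefficients
-- c_σ = q(σ(2)) sum to 2 and make the diagonal, row sums and column sums of E constant; they are also
-- invariant under σ ↦ σ ∘ (0 1), which makes E symmetric in 0 and 1 and pins down its off-diagonal
-- entries.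
module Submission where

open import Data.Fin using (Fin; zero; suc)
open import Data.Integer
open import Data.Integer.Properties
open import Algebra.Properties.CommutativeSemigroup *-commutativeSemigroup using (x∙yz≈y∙xz)
open import Algebra.Properties.Semiring.Sum +-*-semiring
  using (sum; ∑-comm; *-distribˡ-sum; *-distribʳ-sum; sum-cong-≗)
open import Data.Integer.Tactic.RingSolver using (solve-∀)
import Data.Nat as ℕ
open import Data.Product using (∃; _×_; _,_)
open import Data.Sum using (_⊎_; inj₁; inj₂)
open import Data.Vec.Functional using (Vector; _∷_; [])
open import Function.Bundles using (_⇔_; mk⇔)
open import Relation.Binary.PropositionalEquality
open import Relation.Nullary using (contradiction; yes; no)

open import Defs

pattern 𝟑 = suc 𝟐
pattern 𝟒 = suc 𝟑
pattern 𝟓 = suc 𝟒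

Σ3≡sum : ∀ f → Σ3 f ≡ sum f
Σ3≡sum f = reassociate (f 𝟎) (f 𝟏) (f 𝟐)
  where
  reassociate : ∀ a b c → a + b + c ≡ a + (b + (c + 0ℤ))
  reassociate = solve-∀

Σ6≡sum : ∀ f → Σ6 f ≡ sum f
Σ6≡sum f = reassociate (f 𝟎) (f 𝟏) (f 𝟐) (f 𝟑) (f 𝟒) (f 𝟓)
  where
  reassociate : ∀ a b c d e g → a + b + c + d + e + g ≡ a + (b + (c + (d + (e + (g + 0ℤ)))))
  reassociate = solve-∀

Σ3-cong : ∀ {f g : Vector ℤ 3} → (∀ i → f i ≡ g i) → Σ3 f ≡ Σ3 g
Σ3-cong f≗g = cong₂ _+_ (cong₂ _+_ (f≗g 𝟎) (f≗g 𝟏)) (f≗g 𝟐)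

Σ6-cong : ∀ {f g : Vector ℤ 6} → (∀ k → f k ≡ g k) → Σ6 f ≡ Σ6 g
Σ6-cong {f} {g} f≗g = trans (Σ6≡sum f) (trans (sum-cong-≗ f≗g) (sym (Σ6≡sum g)))

Σ3-Σ6-comm : ∀ (g : Fin 3 → Fin 6 → ℤ) → Σ3 (λ i → Σ6 (g i)) ≡ Σ6 (λ k → Σ3 (λ i → g i k))
Σ3-Σ6-comm g = begin
  Σ3 (λ i → Σ6 (g i))            ≡⟨ Σ3-cong (λ i → Σ6≡sum (g i)) ⟩
  Σ3 (λ i → sum (g i))            ≡⟨ Σ3≡sum (λ i → sum (g i)) ⟩
  sum (λ i → sum (g i))           ≡⟨ ∑-comm g ⟩
  sum (λ k → sum (λ i → g i k))   ≡⟨ Σ6≡sum (λ k → sum (λ i → g i k)) ⟨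
  Σ6 (λ k → sum (λ i → g i k))    ≡⟨ Σ6-cong (λ k → Σ3≡sum (λ i → g i k)) ⟨
  Σ6 (λ k → Σ3 (λ i → g i k))     ∎
  where open ≡-Reasoning

*-distribˡ-Σ3 : ∀ x (f : Vector ℤ 3) → x * Σ3 f ≡ Σ3 (λ i → x * f i)
*-distribˡ-Σ3 x f = trans (*-distribˡ-+ x _ (f 𝟐)) (cong (_+ x * f 𝟐) (*-distribˡ-+ x (f 𝟎) (f 𝟏)))

*-distribˡ-Σ6 : ∀ x (f : Vector ℤ 6) → x * Σ6 f ≡ Σ6 (λ k → x * f k)
*-distribˡ-Σ6 x f = trans (cong (x *_) (Σ6≡sum f)) (trans (*-distribˡ-sum x f) (sym (Σ6≡sum (λ k → x * f k))))

*-distribʳ-Σ6 : ∀ x (f : Vector ℤ 6) → Σ6 f * x ≡ Σ6 (λ k → f k * x)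
*-distribʳ-Σ6 x f = trans (cong (_* x) (Σ6≡sum f)) (trans (*-distribʳ-sum x f) (sym (Σ6≡sum (λ k → f k * x))))

Σ3-permute : ∀ k (f : Vector ℤ 3) → Σ3 (λ i → f (σ k i)) ≡ Σ3 f
Σ3-permute 𝟎 f = refl
Σ3-permute 𝟏 f = cong (_+ f 𝟐) (+-comm (f 𝟏) (f 𝟎))
Σ3-permute 𝟐 f = reverse (f 𝟎) (f 𝟏) (f 𝟐)
  where
  reverse : ∀ a b c → c + b + a ≡ a + b + c
  reverse = solve-∀
Σ3-permute 𝟑 f = swap (f 𝟎) (f 𝟏) (f 𝟐)
  where
  swap : ∀ a b c → a + c + b ≡ a + b + c
  swap = solve-∀
Σ3-permute 𝟒 f = rotate (f 𝟎) (f 𝟏) (f 𝟐)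
  where
  rotate : ∀ a b c → b + c + a ≡ a + b + c
  rotate = solve-∀
Σ3-permute 𝟓 f = rotate (f 𝟎) (f 𝟏) (f 𝟐)
  where
  rotate : ∀ a b c → c + a + b ≡ a + b + c
  rotate = solve-∀

1ᵥ : Vector ℤ 3
1ᵥ _ = 1ℤ

Uniform : Vector ℤ 3 → Set
Uniform v = ∀ i → v i ≡ v 𝟎

uniform-≗ : ∀ {u v} → (∀ i → u i ≡ v i) → Uniform v → Uniform u
uniform-≗ u≗v U i = trans (u≗v i) (trans (U i) (sym (u≗v 𝟎)))

Σ3-uniform : ∀ {v} → Uniform v → Σ3 v ≡ + 3 * v 𝟎
Σ3-uniform {v} U = trans (cong₂ (λ x y → v 𝟎 + x + y) (U 𝟏) (U 𝟐)) (triple (v 𝟎))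
  where
  triple : ∀ x → x + x + x ≡ + 3 * x
  triple = solve-∀

NonZeroVec : Vector ℤ 3 → Set
NonZeroVec v = ∃ λ j → v j ≢ 0ℤ

infix 8 _·_
infixr 9 _⨯_
infix 4 _⊥_

_·_ : Vector ℤ 3 → Vector ℤ 3 → ℤ
u · v = Σ3 (λ j → u j * v j)

_⊥_ : Vector ℤ 3 → Vector ℤ 3 → Set
u ⊥ v = u · v ≡ 0ℤ

·-δ : ∀ t m → t · δ m ≡ t m
·-δ t 𝟎 = pick (t 𝟎) (t 𝟏) (t 𝟐)
  where
  pick : ∀ a b c → a * 1ℤ + b * 0ℤ + c * 0ℤ ≡ a
  pick = solve-∀
·-δ t 𝟏 = pick (t 𝟎) (t 𝟏) (t 𝟐)
  where
  pick : ∀ a b c → a * 0ℤ + b * 1ℤ + c * 0ℤ ≡ b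
  pick = solve-∀
·-δ t 𝟐 = pick (t 𝟎) (t 𝟏) (t 𝟐)
  where
  pick : ∀ a b c → a * 0ℤ + b * 0ℤ + c * 1ℤ ≡ c
  pick = solve-∀

·-distribˡ-diff : ∀ t x y → t · (λ j → x j - y j) ≡ t · x - t · y
·-distribˡ-diff t x y = expand (t 𝟎) (t 𝟏) (t 𝟐) (x 𝟎) (x 𝟏) (x 𝟐) (y 𝟎) (y 𝟏) (y 𝟐)
  where
  expand : ∀ t₀ t₁ t₂ x₀ x₁ x₂ y₀ y₁ y₂ →
    t₀ * (x₀ - y₀) + t₁ * (x₁ - y₁) + t₂ * (x₂ - y₂)
    ≡ (t₀ * x₀ + t₁ * x₁ + t₂ * x₂) - (t₀ * y₀ + t₁ * y₁ + t₂ * y₂)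
  expand = solve-∀

_⨯_ : Vector ℤ 3 → Vector ℤ 3 → Vector ℤ 3
(a ⨯ b) 𝟎 = a 𝟏 * b 𝟐 - a 𝟐 * b 𝟏
(a ⨯ b) 𝟏 = a 𝟐 * b 𝟎 - a 𝟎 * b 𝟐
(a ⨯ b) 𝟐 = a 𝟎 * b 𝟏 - a 𝟏 * b 𝟎

det : Vector ℤ 3 → Vector ℤ 3 → Vector ℤ 3 → ℤ
det a b c = (a ⨯ b) · c

dual-basis : ∀ a b c w i → w i * det a b c ≡ a · w * (b ⨯ c) i + b · w * (c ⨯ a) i + c · w * (a ⨯ b) i
dual-basis a b c w 𝟎 = expand (a 𝟎) (a 𝟏) (a 𝟐) (b 𝟎) (b 𝟏) (b 𝟐) (c 𝟎) (c 𝟏) (c 𝟐) (w 𝟎) (w 𝟏) (w 𝟐)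
  where
  expand : ∀ a₀ a₁ a₂ b₀ b₁ b₂ c₀ c₁ c₂ w₀ w₁ w₂ →
    w₀ * ((a₁ * b₂ - a₂ * b₁) * c₀ + (a₂ * b₀ - a₀ * b₂) * c₁ + (a₀ * b₁ - a₁ * b₀) * c₂)
    ≡ (a₀ * w₀ + a₁ * w₁ + a₂ * w₂) * (b₁ * c₂ - b₂ * c₁) + (b₀ * w₀ + b₁ * w₁ + b₂ * w₂) * (c₁ * a₂ - c₂ * a₁)
      + (c₀ * w₀ + c₁ * w₁ + c₂ * w₂) * (a₁ * b₂ - a₂ * b₁)
  expand = solve-∀
dual-basis a b c w 𝟏 = expand (a 𝟎) (a 𝟏) (a 𝟐) (b 𝟎) (b 𝟏) (b 𝟐) (c 𝟎) (c 𝟏) (c 𝟐) (w 𝟎) (w 𝟏) (w 𝟐)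
  where
  expand : ∀ a₀ a₁ a₂ b₀ b₁ b₂ c₀ c₁ c₂ w₀ w₁ w₂ →
    w₁ * ((a₁ * b₂ - a₂ * b₁) * c₀ + (a₂ * b₀ - a₀ * b₂) * c₁ + (a₀ * b₁ - a₁ * b₀) * c₂)
    ≡ (a₀ * w₀ + a₁ * w₁ + a₂ * w₂) * (b₂ * c₀ - b₀ * c₂) + (b₀ * w₀ + b₁ * w₁ + b₂ * w₂) * (c₂ * a₀ - c₀ * a₂)
      + (c₀ * w₀ + c₁ * w₁ + c₂ * w₂) * (a₂ * b₀ - a₀ * b₂)
  expand = solve-∀
dual-basis a b c w 𝟐 = expand (a 𝟎) (a 𝟏) (a 𝟐) (b 𝟎) (b 𝟏) (b 𝟐) (c 𝟎) (c 𝟏) (c 𝟐) (w 𝟎) (w 𝟏) (w 𝟐)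
  where
  expand : ∀ a₀ a₁ a₂ b₀ b₁ b₂ c₀ c₁ c₂ w₀ w₁ w₂ →
    w₂ * ((a₁ * b₂ - a₂ * b₁) * c₀ + (a₂ * b₀ - a₀ * b₂) * c₁ + (a₀ * b₁ - a₁ * b₀) * c₂)
    ≡ (a₀ * w₀ + a₁ * w₁ + a₂ * w₂) * (b₀ * c₁ - b₁ * c₀) + (b₀ * w₀ + b₁ * w₁ + b₂ * w₂) * (c₀ * a₁ - c₁ * a₀)
      + (c₀ * w₀ + c₁ * w₁ + c₂ * w₂) * (a₀ * b₁ - a₁ * b₀)
  expand = solve-∀

i*j≡0⇒j≡0 : ∀ {i j} → i ≢ 0ℤ → i * j ≡ 0ℤ → j ≡ 0ℤ
i*j≡0⇒j≡0 {i} i≢0 ij≡0 with i*j≡0⇒i≡0∨j≡0 i ij≡0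
... | inj₁ i≡0 = contradiction i≡0 i≢0
... | inj₂ j≡0 = j≡0

det-of-⊥ : ∀ {a b c w} → NonZeroVec w → a ⊥ w → b ⊥ w → c ⊥ w → det a b c ≡ 0ℤ
det-of-⊥ {a} {b} {c} {w} (j , wⱼ≢0) a⊥w b⊥w c⊥w = i*j≡0⇒j≡0 wⱼ≢0 (trans (dual-basis a b c w j) vanish)
  where
  vanish : a · w * (b ⨯ c) j + b · w * (c ⨯ a) j + c · w * (a ⨯ b) j ≡ 0ℤ
  vanish rewrite a⊥w | b⊥w | c⊥w = refl

⊥-of-det : ∀ {a b c w} → NonZeroVec (a ⨯ b) → det a b c ≡ 0ℤ → a ⊥ w → b ⊥ w → c ⊥ w
⊥-of-det {a} {b} {c} {w} (j , a⨯b≢0) det≡0 a⊥w b⊥w = i*j≡0⇒j≡0 a⨯b≢0 (begin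
  (a ⨯ b) j * c · w                                          ≡⟨ *-comm ((a ⨯ b) j) (c · w) ⟩
  c · w * (a ⨯ b) j                                          ≡⟨ +-identityˡ _ ⟨
  0ℤ + c · w * (a ⨯ b) j
    ≡⟨ cong₂ (λ x y → x * (b ⨯ c) j + y * (c ⨯ a) j + c · w * (a ⨯ b) j) a⊥w b⊥w ⟨
  a · w * (b ⨯ c) j + b · w * (c ⨯ a) j + c · w * (a ⨯ b) j  ≡⟨ dual-basis a b c w j ⟨
  w j * det a b c                                            ≡⟨ cong (w j *_) det≡0 ⟩
  w j * 0ℤ                                                   ≡⟨ *-zeroʳ (w j) ⟩
  0ℤ                                                         ∎)
  where open ≡-Reasoning

-- Ternary witnesses

record IsTernaryWeight (t q : Vector ℤ 3) : Set where
  constructor ternaryWeight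
  field
    sum≡1   : Σ3 q ≡ 1ℤ
    average : + 3 * (t · q) ≡ Σ3 t

open IsTernaryWeight

weight⇒ternary : ∀ {t q} → IsTernaryWeight t q → TernaryVec t
weight⇒ternary {q = q} (ternaryWeight Σq≡1 avg) = q 𝟎 , q 𝟏 , q 𝟐 , Σq≡1 , avg

ternary⇒weight : ∀ {t} → TernaryVec t → ∃ (IsTernaryWeight t)
ternary⇒weight (x , y , z , Σq≡1 , avg) = (x ∷ y ∷ z ∷ []) , ternaryWeight Σq≡1 avg

centre : Vector ℤ 3 → Vector ℤ 3
centre q j = + 3 * q j - 1ℤ

·-centre : ∀ t q → t · centre q ≡ + 3 * (t · q) - Σ3 t
·-centre t q = expand (t 𝟎) (t 𝟏) (t 𝟐) (q 𝟎) (q 𝟏) (q 𝟐)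
  where
  expand : ∀ t₀ t₁ t₂ q₀ q₁ q₂ →
    t₀ * (+ 3 * q₀ - 1ℤ) + t₁ * (+ 3 * q₁ - 1ℤ) + t₂ * (+ 3 * q₂ - 1ℤ)
    ≡ + 3 * (t₀ * q₀ + t₁ * q₁ + t₂ * q₂) - (t₀ + t₁ + t₂)
  expand = solve-∀

weight⇒⊥ : ∀ {t q} → IsTernaryWeight t q → t ⊥ centre q
weight⇒⊥ {t} {q} w = trans (·-centre t q) (trans (cong (_- Σ3 t) (average w)) (+-inverseʳ (Σ3 t)))

⊥⇒weight : ∀ {t q} → Σ3 q ≡ 1ℤ → t ⊥ centre q → IsTernaryWeight t q
⊥⇒weight {t} {q} Σq≡1 t⊥ = ternaryWeight Σq≡1 (i-j≡0⇒i≡j _ _ (trans (sym (·-centre t q)) t⊥))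

1ᵥ-weight : ∀ {q} → Σ3 q ≡ 1ℤ → IsTernaryWeight 1ᵥ q
1ᵥ-weight {q} Σq≡1 = ternaryWeight Σq≡1 (cong (+ 3 *_) (trans (Σ3-cong (λ j → *-identityˡ (q j))) Σq≡1))

weight-transfer : ∀ {v t s q} → NonZeroVec v → 1ᵥ ⊥ v → t ⊥ v → s ⊥ v → NonZeroVec (1ᵥ ⨯ t) →
  IsTernaryWeight t q → IsTernaryWeight s q
weight-transfer {v} {t} {s} {q} v≢0 1⊥v t⊥v s⊥v 1⨯t≢0 w = ⊥⇒weight (sum≡1 w)
  (⊥-of-det {1ᵥ} {t} {s} {centre q} 1⨯t≢0 (det-of-⊥ {1ᵥ} {t} {s} {v} v≢0 1⊥v t⊥v s⊥v)
    (weight⇒⊥ (1ᵥ-weight {q} (sum≡1 w))) (weight⇒⊥ w))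

uniform-weight : ∀ {t q} → Uniform t → Σ3 q ≡ 1ℤ → IsTernaryWeight t q
uniform-weight {t} {q} U Σq≡1 = ternaryWeight Σq≡1 constant-average
  where
  factor : ∀ x a b c → + 3 * (x * a + x * b + x * c) ≡ (x + x + x) * (a + b + c)
  factor = solve-∀
  constant-average : + 3 * (t 𝟎 * q 𝟎 + t 𝟏 * q 𝟏 + t 𝟐 * q 𝟐) ≡ t 𝟎 + t 𝟏 + t 𝟐
  constant-average rewrite U 𝟏 | U 𝟐 =
    trans (factor (t 𝟎) (q 𝟎) (q 𝟏) (q 𝟐)) (trans (cong ((t 𝟎 + t 𝟎 + t 𝟎) *_) Σq≡1) (*-identityʳ _))

1*i-1*j≡0⇒i≡j : ∀ {i j} → 1ℤ * i - 1ℤ * j ≡ 0ℤ → i ≡ j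
1*i-1*j≡0⇒i≡j {i} {j} e = subst₂ _≡_ (*-identityˡ i) (*-identityˡ j) (i-j≡0⇒i≡j _ _ e)

uniform? : ∀ t → Uniform t ⊎ NonZeroVec (1ᵥ ⨯ t)
uniform? t with t 𝟏 ≟ t 𝟎 | t 𝟐 ≟ t 𝟎
... | yes t₁≡t₀ | yes t₂≡t₀ = inj₁ λ { 𝟎 → refl ; 𝟏 → t₁≡t₀ ; 𝟐 → t₂≡t₀ }
... | no t₁≢t₀  | _         = inj₂ (𝟐 , λ e → t₁≢t₀ (1*i-1*j≡0⇒i≡j e))
... | yes _     | no t₂≢t₀  = inj₂ (𝟏 , λ e → t₂≢t₀ (sym (1*i-1*j≡0⇒i≡j e)))

CommonWeight : Mat 3 3 → Vector ℤ 3 → Set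
CommonWeight A q = IsTernaryWeight (diag A) q × IsTernaryWeight (rowSum A) q × IsTernaryWeight (colSum A) q

common-weight : ∀ A → RankLt3 (Θ A) → TernaryVec (rowSum A) → TernaryVec (colSum A) → TernaryVec (diag A) →
  ∃ (CommonWeight A)
common-weight A (v , v≢0 , Θ⊥v) tr tc td =
  pick (ternary⇒weight td) (ternary⇒weight tr) (ternary⇒weight tc) (uniform? _) (uniform? _) (uniform? _)
  where
  Weight Dichotomy : Fin 4 → Set
  Weight i = ∃ (IsTernaryWeight (Θ A i))
  Dichotomy i = Uniform (Θ A i) ⊎ NonZeroVec (1ᵥ ⨯ Θ A i)

  adopt : ∀ i j {q} → IsTernaryWeight (Θ A i) q → Uniform (Θ A j) ⊎ NonZeroVec (1ᵥ ⨯ Θ A i) →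
    IsTernaryWeight (Θ A j) q
  adopt i j w (inj₁ uniform)     = uniform-weight uniform (sum≡1 w)
  adopt i j w (inj₂ nonconstant) = weight-transfer v≢0 (Θ⊥v 𝟎) (Θ⊥v i) (Θ⊥v j) nonconstant w

  pick : Weight 𝟏 → Weight 𝟐 → Weight 𝟑 → Dichotomy 𝟏 → Dichotomy 𝟐 → Dichotomy 𝟑 → ∃ (CommonWeight A)
  pick (qd , wd) _ _ (inj₂ d≁) _ _ =
    qd , wd , adopt 𝟏 𝟐 wd (inj₂ d≁) , adopt 𝟏 𝟑 wd (inj₂ d≁)
  pick _ (qr , wr) _ (inj₁ d≈) (inj₂ r≁) _ =
    qr , adopt 𝟐 𝟏 wr (inj₁ d≈) , wr , adopt 𝟐 𝟑 wr (inj₂ r≁)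
  pick _ _ (qc , wc) (inj₁ d≈) (inj₁ r≈) (inj₂ c≁) =
    qc , adopt 𝟑 𝟏 wc (inj₁ d≈) , adopt 𝟑 𝟐 wc (inj₁ r≈) , wc
  pick (qd , wd) _ _ (inj₁ _) (inj₁ r≈) (inj₁ c≈) =
    qd , wd , adopt 𝟏 𝟐 wd (inj₁ r≈) , adopt 𝟏 𝟑 wd (inj₁ c≈)

0<i≤2⇒i≡1∨i≡2 : ∀ {i} → 0ℤ < i → i ≤ + 2 → i ≡ + 1 ⊎ i ≡ + 2
0<i≤2⇒i≡1∨i≡2 {+ 1} _ _ = inj₁ refl
0<i≤2⇒i≡1∨i≡2 {+ 2} _ _ = inj₂ refl
0<i≤2⇒i≡1∨i≡2 {+ 0} (+<+ ()) _
0<i≤2⇒i≡1∨i≡2 {+ ℕ.suc (ℕ.suc (ℕ.suc n))} _ (+≤+ (ℕ.s≤s (ℕ.s≤s ())))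

3*i≢1∨2 : ∀ i {s} → s ≡ + 1 ⊎ s ≡ + 2 → + 3 * i ≢ s
3*i≢1∨2 (+ 0) (inj₁ refl) ()
3*i≢1∨2 (+ 0) (inj₂ refl) ()
3*i≢1∨2 (+ 1) (inj₁ refl) ()
3*i≢1∨2 (+ 1) (inj₂ refl) ()
3*i≢1∨2 (+ 2) (inj₁ refl) ()
3*i≢1∨2 (+ 2) (inj₂ refl) ()
3*i≢1∨2 (+ ℕ.suc (ℕ.suc (ℕ.suc n))) (inj₁ refl) ()
3*i≢1∨2 (+ ℕ.suc (ℕ.suc (ℕ.suc n))) (inj₂ refl) ()
3*i≢1∨2 -[1+ n ] (inj₁ refl) ()
3*i≢1∨2 -[1+ n ] (inj₂ refl) ()

-- For total weight 2 the witness is 1 - q.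
average⇒ternary : ∀ t q {s} → Σ3 q ≡ s → + 3 * (t · q) ≡ s * Σ3 t → s ≡ + 1 ⊎ s ≡ + 2 → TernaryVec t
average⇒ternary t q Σq≡1 avg (inj₁ refl) =
  weight⇒ternary {t} {q} (ternaryWeight Σq≡1 (trans avg (*-identityˡ (Σ3 t))))
average⇒ternary t q Σq≡2 avg (inj₂ refl) = weight⇒ternary {t} {λ j → 1ℤ - q j} (ternaryWeight
  (trans (sum-complement (q 𝟎) (q 𝟏) (q 𝟐)) (cong (λ x → + 3 - x) Σq≡2))
  (trans (average-complement (t 𝟎) (t 𝟏) (t 𝟐) (q 𝟎) (q 𝟏) (q 𝟐))
    (trans (cong (λ x → + 3 * Σ3 t - x) avg) (three-minus-two (Σ3 t)))))
  where
  sum-complement : ∀ q₀ q₁ q₂ → (1ℤ - q₀) + (1ℤ - q₁) + (1ℤ - q₂) ≡ + 3 - (q₀ + q₁ + q₂)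
  sum-complement = solve-∀
  average-complement : ∀ t₀ t₁ t₂ q₀ q₁ q₂ →
    + 3 * (t₀ * (1ℤ - q₀) + t₁ * (1ℤ - q₁) + t₂ * (1ℤ - q₂))
    ≡ + 3 * (t₀ + t₁ + t₂) - + 3 * (t₀ * q₀ + t₁ * q₁ + t₂ * q₂)
  average-complement = solve-∀
  three-minus-two : ∀ x → + 3 * x - + 2 * x ≡ x
  three-minus-two = solve-∀

-- Weighted sums over S₃

act : Vector ℤ 6 → Vector ℤ 3 → Vector ℤ 3
act c t i = Σ6 (λ k → c k * t (σ k i))

permSum : Vector ℤ 6 → Mat 3 3
permSum c i j = Σ6 (λ k → c k * δ (σ k i) j)

·-permSum : ∀ t c i → t · permSum c i ≡ act c t i
·-permSum t c i = begin
  Σ3 (λ j → t j * Σ6 (λ k → c k * δ (σ k i) j))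
    ≡⟨ Σ3-cong (λ j → trans (*-distribˡ-Σ6 (t j) (λ k → c k * δ (σ k i) j))
                              (Σ6-cong (λ k → x∙yz≈y∙xz (t j) (c k) (δ (σ k i) j)))) ⟩
  Σ3 (λ j → Σ6 (λ k → c k * (t j * δ (σ k i) j)))
    ≡⟨ Σ3-Σ6-comm (λ j k → c k * (t j * δ (σ k i) j)) ⟩
  Σ6 (λ k → Σ3 (λ j → c k * (t j * δ (σ k i) j)))
    ≡⟨ Σ6-cong (λ k → trans (sym (*-distribˡ-Σ3 (c k) (λ j → t j * δ (σ k i) j)))
                            (cong (c k *_) (·-δ t (σ k i)))) ⟩
  act c t i ∎
  where open ≡-Reasoning

Σ3-act-permute : ∀ (c : Vector ℤ 6) (F : Fin 6 → Vector ℤ 3) →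
  Σ3 (λ j → Σ6 (λ k → c k * F k (σ k j))) ≡ Σ6 (λ k → c k * Σ3 (F k))
Σ3-act-permute c F = trans (Σ3-Σ6-comm (λ j k → c k * F k (σ k j)))
  (Σ6-cong (λ k → trans (sym (*-distribˡ-Σ3 (c k) (λ j → F k (σ k j)))) (cong (c k *_) (Σ3-permute k (F k)))))

rowSum-combo : ∀ A (c : Vector ℤ 6) i → rowSum (combo A c) i ≡ act c (rowSum A) i
rowSum-combo A c i = Σ3-act-permute c (λ k → A (σ k i))

colSum-combo : ∀ A (c : Vector ℤ 6) j → colSum (combo A c) j ≡ act c (colSum A) j
colSum-combo A c j = Σ3-act-permute c (λ k m → A m (σ k j))

Σ3-act : ∀ (c : Vector ℤ 6) t → Σ3 (act c t) ≡ Σ6 c * Σ3 t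
Σ3-act c t = trans (Σ3-act-permute c (λ _ → t)) (sym (*-distribʳ-Σ6 (Σ3 t) c))

Σ3-permSum-row : ∀ c i → Σ3 (permSum c i) ≡ Σ6 c
Σ3-permSum-row c i = begin
  Σ3 (permSum c i)           ≡⟨ Σ3-cong (λ j → *-identityˡ (permSum c i j)) ⟨
  1ᵥ · permSum c i           ≡⟨ ·-permSum 1ᵥ c i ⟩
  Σ6 (λ k → c k * 1ℤ)        ≡⟨ Σ6-cong (λ k → *-identityʳ (c k)) ⟩
  Σ6 c                       ∎
  where open ≡-Reasoning

Σ3-permSum-column : ∀ c j → Σ3 (λ i → permSum c i j) ≡ Σ6 c
Σ3-permSum-column c j = trans (Σ3-act c (λ m → δ m j)) (trans (cong (Σ6 c *_) (Σ3-δ j)) (*-identityʳ (Σ6 c)))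
  where
  Σ3-δ : ∀ j → Σ3 (λ m → δ m j) ≡ 1ℤ
  Σ3-δ 𝟎 = refl
  Σ3-δ 𝟏 = refl
  Σ3-δ 𝟐 = refl

uniform⇒⊥ : ∀ c t → Uniform (act c t) → ∀ i → t ⊥ (λ j → permSum c 𝟎 j - permSum c i j)
uniform⇒⊥ c t U i = begin
  t · (λ j → permSum c 𝟎 j - permSum c i j)  ≡⟨ ·-distribˡ-diff t (permSum c 𝟎) (permSum c i) ⟩
  t · permSum c 𝟎 - t · permSum c i          ≡⟨ cong₂ _-_ (·-permSum t c 𝟎) (·-permSum t c i) ⟩
  act c t 𝟎 - act c t i                      ≡⟨ cong (λ x → act c t 𝟎 - x) (U i) ⟩
  act c t 𝟎 - act c t 𝟎                      ≡⟨ +-inverseʳ (act c t 𝟎) ⟩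
  0ℤ                                         ∎
  where open ≡-Reasoning

uniform⇒average : ∀ c t → Uniform (act c t) → + 3 * (t · permSum c 𝟎) ≡ Σ6 c * Σ3 t
uniform⇒average c t U = begin
  + 3 * (t · permSum c 𝟎)  ≡⟨ cong (+ 3 *_) (·-permSum t c 𝟎) ⟩
  + 3 * act c t 𝟎          ≡⟨ Σ3-uniform U ⟨
  Σ3 (act c t)             ≡⟨ Σ3-act c t ⟩
  Σ6 c * Σ3 t              ∎
  where open ≡-Reasoning

-- Matrices in ⟨I, J⟩

δ-refl : ∀ {n} (i : Fin n) → δ i i ≡ 1ℤ
δ-refl zero    = refl
δ-refl (suc i) = δ-refl i

InIJ⇒uniform-diag : ∀ {M} → InIJ M → Uniform (diag M)
InIJ⇒uniform-diag (a , b , M≡) i = trans (M≡ i i) (trans (cong (λ d → a * d + b) (δ-refl i)) (sym (M≡ 𝟎 𝟎)))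

-- The transposition (0 i) carries row and column i of aI + bJ onto row and column 0.
InIJ⇒uniform-rowSum : ∀ {M} → InIJ M → Uniform (rowSum M)
InIJ⇒uniform-rowSum (a , b , M≡) i = trans (Σ3-cong (M≡ i)) (trans (row-of-IJ i) (sym (Σ3-cong (M≡ 𝟎))))
  where
  row-of-IJ : ∀ i → Σ3 (λ j → a * δ i j + b) ≡ Σ3 (λ j → a * δ 𝟎 j + b)
  row-of-IJ 𝟎 = refl
  row-of-IJ 𝟏 = sym (Σ3-permute 𝟏 (λ j → a * δ 𝟏 j + b))
  row-of-IJ 𝟐 = sym (Σ3-permute 𝟐 (λ j → a * δ 𝟐 j + b))

InIJ⇒uniform-colSum : ∀ {M} → InIJ M → Uniform (colSum M)
InIJ⇒uniform-colSum (a , b , M≡) j =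
  trans (Σ3-cong (λ i → M≡ i j)) (trans (column-of-IJ j) (sym (Σ3-cong (λ i → M≡ i 𝟎))))
  where
  column-of-IJ : ∀ j → Σ3 (λ i → a * δ i j + b) ≡ Σ3 (λ i → a * δ i 𝟎 + b)
  column-of-IJ 𝟎 = refl
  column-of-IJ 𝟏 = sym (Σ3-permute 𝟏 (λ i → a * δ i 𝟏 + b))
  column-of-IJ 𝟐 = sym (Σ3-permute 𝟐 (λ i → a * δ i 𝟐 + b))

InIJ⇒uniform-act : ∀ A c → InIJ (combo A c) → ∀ r → Uniform (act c (Θ A r))
InIJ⇒uniform-act A c E∈IJ 𝟎 i = refl
InIJ⇒uniform-act A c E∈IJ 𝟏 = InIJ⇒uniform-diag E∈IJ
InIJ⇒uniform-act A c E∈IJ 𝟐 = uniform-≗ (λ i → sym (rowSum-combo A c i)) (InIJ⇒uniform-rowSum E∈IJ)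
InIJ⇒uniform-act A c E∈IJ 𝟑 = uniform-≗ (λ i → sym (colSum-combo A c i)) (InIJ⇒uniform-colSum E∈IJ)

a+b+c≡b+a+d⇒c≡d : ∀ {a b c d} → a + b + c ≡ b + a + d → c ≡ d
a+b+c≡b+a+d⇒c≡d {a} {b} {c} {d} e = i-j≡0⇒i≡j c d (trans (regroup a b c d) (i≡j⇒i-j≡0 e))
  where
  regroup : ∀ a b c d → c - d ≡ (a + b + c) - (b + a + d)
  regroup = solve-∀

x+x+d≡d+u+v⇒x+x≡u+v : ∀ {x d u v} → x + x + d ≡ d + u + v → x + x ≡ u + v
x+x+d≡d+u+v⇒x+x≡u+v {x} {d} {u} {v} e = i-j≡0⇒i≡j _ _ (trans (regroup x d u v) (i≡j⇒i-j≡0 e))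
  where
  regroup : ∀ x d u v → (x + x) - (u + v) ≡ (x + x + d) - (d + u + v)
  regroup = solve-∀

x+x≡a+y⇒y+y≡a+x⇒x≡a : ∀ {a x y} → x + x ≡ a + y → y + y ≡ a + x → x ≡ a
x+x≡a+y⇒y+y≡a+x⇒x≡a {a} {x} {y} ex ey = i-j≡0⇒i≡j x a (*-cancelˡ-≡ (+ 3) (x - a) 0ℤ (begin
  + 3 * (x - a)                                          ≡⟨ combine a x y ⟩
  + 2 * ((x + x) - (a + y)) + ((y + y) - (a + x))
    ≡⟨ cong₂ (λ u v → + 2 * u + v) (i≡j⇒i-j≡0 ex) (i≡j⇒i-j≡0 ey) ⟩
  0ℤ                                                     ∎))
  where
  open ≡-Reasoning
  combine : ∀ a x y → + 3 * (x - a) ≡ + 2 * ((x + x) - (a + y)) + ((y + y) - (a + x))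
  combine = solve-∀

uniform⇒InIJ : ∀ {M} → Uniform (diag M) → Uniform (rowSum M) → Uniform (colSum M) → M 𝟏 𝟎 ≡ M 𝟎 𝟏 → InIJ M
uniform⇒InIJ {M} d r c s = M 𝟎 𝟎 - M 𝟎 𝟏 , M 𝟎 𝟏 , entry
  where
  m₁₂≡m₀₂ : M 𝟏 𝟐 ≡ M 𝟎 𝟐
  m₁₂≡m₀₂ = a+b+c≡b+a+d⇒c≡d {M 𝟎 𝟏} {M 𝟎 𝟎}
    (subst₂ (λ x y → x + y + M 𝟏 𝟐 ≡ M 𝟎 𝟎 + M 𝟎 𝟏 + M 𝟎 𝟐) s (d 𝟏) (r 𝟏))
  m₂₁≡m₂₀ : M 𝟐 𝟏 ≡ M 𝟐 𝟎
  m₂₁≡m₂₀ = a+b+c≡b+a+d⇒c≡d {M 𝟎 𝟏} {M 𝟎 𝟎}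
    (subst₂ (λ x y → M 𝟎 𝟏 + y + M 𝟐 𝟏 ≡ M 𝟎 𝟎 + x + M 𝟐 𝟎) s (d 𝟏) (c 𝟏))
  row₂ : M 𝟐 𝟎 + M 𝟐 𝟎 ≡ M 𝟎 𝟏 + M 𝟎 𝟐
  row₂ = x+x+d≡d+u+v⇒x+x≡u+v {M 𝟐 𝟎} {M 𝟎 𝟎}
    (subst₂ (λ x y → M 𝟐 𝟎 + x + y ≡ M 𝟎 𝟎 + M 𝟎 𝟏 + M 𝟎 𝟐) m₂₁≡m₂₀ (d 𝟐) (r 𝟐))
  column₂ : M 𝟎 𝟐 + M 𝟎 𝟐 ≡ M 𝟎 𝟏 + M 𝟐 𝟎
  column₂ = x+x+d≡d+u+v⇒x+x≡u+v {M 𝟎 𝟐} {M 𝟎 𝟎}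
    (subst₂ (λ x y → M 𝟎 𝟐 + x + M 𝟎 𝟎 ≡ M 𝟎 𝟎 + y + M 𝟐 𝟎) m₁₂≡m₀₂ s
      (trans (cong (λ z → M 𝟎 𝟐 + M 𝟏 𝟐 + z) (sym (d 𝟐))) (c 𝟐)))
  m₂₀≡m₀₁ : M 𝟐 𝟎 ≡ M 𝟎 𝟏
  m₂₀≡m₀₁ = x+x≡a+y⇒y+y≡a+x⇒x≡a row₂ column₂
  m₀₂≡m₀₁ : M 𝟎 𝟐 ≡ M 𝟎 𝟏
  m₀₂≡m₀₁ = x+x≡a+y⇒y+y≡a+x⇒x≡a column₂ row₂

  on-diagonal : ∀ i → M i i ≡ (M 𝟎 𝟎 - M 𝟎 𝟏) * 1ℤ + M 𝟎 𝟏
  on-diagonal i = trans (d i) (restore (M 𝟎 𝟎) (M 𝟎 𝟏))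
    where
    restore : ∀ a b → a ≡ (a - b) * 1ℤ + b
    restore = solve-∀
  off-diagonal : ∀ {x} → x ≡ M 𝟎 𝟏 → x ≡ (M 𝟎 𝟎 - M 𝟎 𝟏) * 0ℤ + M 𝟎 𝟏
  off-diagonal x≡ = trans x≡ (pad (M 𝟎 𝟎 - M 𝟎 𝟏) (M 𝟎 𝟏))
    where
    pad : ∀ a b → b ≡ a * 0ℤ + b
    pad = solve-∀

  entry : ∀ i j → M i j ≡ (M 𝟎 𝟎 - M 𝟎 𝟏) * δ i j + M 𝟎 𝟏
  entry 𝟎 𝟎 = on-diagonal 𝟎
  entry 𝟏 𝟏 = on-diagonal 𝟏
  entry 𝟐 𝟐 = on-diagonal 𝟐
  entry 𝟎 𝟏 = off-diagonal refl
  entry 𝟎 𝟐 = off-diagonal m₀₂≡m₀₁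
  entry 𝟏 𝟎 = off-diagonal s
  entry 𝟏 𝟐 = off-diagonal (trans m₁₂≡m₀₂ m₀₂≡m₀₁)
  entry 𝟐 𝟎 = off-diagonal m₂₀≡m₀₁
  entry 𝟐 𝟏 = off-diagonal (trans m₂₁≡m₂₀ m₂₀≡m₀₁)

module _ (A : Mat 3 3) (c : Vector ℤ 6) (balanced : ∀ r → Uniform (act c (Θ A r)))
         (Σc≡1∨2 : Σ6 c ≡ + 1 ⊎ Σ6 c ≡ + 2) where

  balanced⇒ternary : ∀ r → TernaryVec (Θ A r)
  balanced⇒ternary r = average⇒ternary (Θ A r) (permSum c 𝟎) (Σ3-permSum-row c 𝟎)
    (uniform⇒average c (Θ A r) (balanced r)) Σc≡1∨2

  balanced⇒rank : RankLt3 (Θ A)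
  balanced⇒rank with permSum c 𝟎 𝟎 ≟ permSum c 𝟏 𝟎 | permSum c 𝟎 𝟎 ≟ permSum c 𝟐 𝟎
  ... | no P₀₀≢P₁₀ | _ =
    (λ j → permSum c 𝟎 j - permSum c 𝟏 j) , (𝟎 , λ e → P₀₀≢P₁₀ (i-j≡0⇒i≡j _ _ e)) ,
    λ r → uniform⇒⊥ c (Θ A r) (balanced r) 𝟏
  ... | yes _ | no P₀₀≢P₂₀ =
    (λ j → permSum c 𝟎 j - permSum c 𝟐 j) , (𝟎 , λ e → P₀₀≢P₂₀ (i-j≡0⇒i≡j _ _ e)) ,
    λ r → uniform⇒⊥ c (Θ A r) (balanced r) 𝟐
  ... | yes P₀₀≡P₁₀ | yes P₀₀≡P₂₀ =
    contradiction (trans (sym (Σ3-uniform column-uniform)) (Σ3-permSum-column c 𝟎))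
                  (3*i≢1∨2 (permSum c 𝟎 𝟎) Σc≡1∨2)
    where
    column-uniform : Uniform (λ i → permSum c i 𝟎)
    column-uniform 𝟎 = refl
    column-uniform 𝟏 = sym P₀₀≡P₁₀
    column-uniform 𝟐 = sym P₀₀≡P₂₀

weights : Vector ℤ 3 → Vector ℤ 6
weights q k = q (σ k 𝟐)

Σ6-weights : ∀ q → Σ6 (weights q) ≡ + 2 * Σ3 q
Σ6-weights q = collect (q 𝟎) (q 𝟏) (q 𝟐)
  where
  collect : ∀ q₀ q₁ q₂ → q₂ + q₂ + q₀ + q₁ + q₀ + q₁ ≡ + 2 * (q₀ + q₁ + q₂)
  collect = solve-∀

weight⇒uniform-act : ∀ {t q} → IsTernaryWeight t q → Uniform (act (weights q) t)
weight⇒uniform-act _ 𝟎 = refl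
weight⇒uniform-act {t} {q} _ 𝟏 = reorder (t 𝟎) (t 𝟏) (t 𝟐) (q 𝟎) (q 𝟏) (q 𝟐)
  where
  reorder : ∀ t₀ t₁ t₂ q₀ q₁ q₂ →
    q₂ * t₁ + q₂ * t₀ + q₀ * t₁ + q₁ * t₂ + q₀ * t₂ + q₁ * t₀
    ≡ q₂ * t₀ + q₂ * t₁ + q₀ * t₂ + q₁ * t₀ + q₀ * t₁ + q₁ * t₂
  reorder = solve-∀
weight⇒uniform-act {t} {q} (ternaryWeight Σq≡1 avg) 𝟐 = i-j≡0⇒i≡j _ _ (begin
  act (weights q) t 𝟐 - act (weights q) t 𝟎            ≡⟨ expand (t 𝟎) (t 𝟏) (t 𝟐) (q 𝟎) (q 𝟏) (q 𝟐) ⟩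
  (+ 3 * (t · q) - Σ3 t) - Σ3 t * (Σ3 q - 1ℤ)         ≡⟨ cong₂ (λ x y → (x - Σ3 t) - Σ3 t * (y - 1ℤ)) avg Σq≡1 ⟩
  (Σ3 t - Σ3 t) - Σ3 t * (1ℤ - 1ℤ)                    ≡⟨ vanish (Σ3 t) ⟩
  0ℤ                                                  ∎)
  where
  open ≡-Reasoning
  expand : ∀ t₀ t₁ t₂ q₀ q₁ q₂ →
    (q₂ * t₂ + q₂ * t₂ + q₀ * t₀ + q₁ * t₁ + q₀ * t₀ + q₁ * t₁)
      - (q₂ * t₀ + q₂ * t₁ + q₀ * t₂ + q₁ * t₀ + q₀ * t₁ + q₁ * t₂)
    ≡ (+ 3 * (t₀ * q₀ + t₁ * q₁ + t₂ * q₂) - (t₀ + t₁ + t₂)) - (t₀ + t₁ + t₂) * ((q₀ + q₁ + q₂) - 1ℤ)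
  expand = solve-∀
  vanish : ∀ x → (x - x) - x * (1ℤ - 1ℤ) ≡ 0ℤ
  vanish = solve-∀

-- c_σ = q(σ 2) is invariant under σ ↦ σ ∘ (0 1), so conjugating by (0 1) only permutes the summands.
combo-weights-symmetric : ∀ A q → combo A (weights q) 𝟏 𝟎 ≡ combo A (weights q) 𝟎 𝟏
combo-weights-symmetric A q =
  reorder (q 𝟐 * A 𝟏 𝟎) (q 𝟐 * A 𝟎 𝟏) (q 𝟎 * A 𝟏 𝟐) (q 𝟏 * A 𝟐 𝟎) (q 𝟎 * A 𝟐 𝟏) (q 𝟏 * A 𝟎 𝟐)
  where
  reorder : ∀ x₁ x₂ x₃ x₄ x₅ x₆ → x₁ + x₂ + x₃ + x₄ + x₅ + x₆ ≡ x₂ + x₁ + x₅ + x₆ + x₃ + x₄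
  reorder = solve-∀

common-weight⇒balanced : ∀ A q → CommonWeight A q → BalLe A (+ 2)
common-weight⇒balanced A q (wd , wr , wc) =
  weights q , subst (0ℤ <_) (sym Σ≡2) (+<+ (ℕ.s≤s ℕ.z≤n)) , subst (_≤ + 2) (sym Σ≡2) ≤-refl ,
  uniform⇒InIJ (weight⇒uniform-act wd)
    (uniform-≗ (rowSum-combo A (weights q)) (weight⇒uniform-act wr))
    (uniform-≗ (colSum-combo A (weights q)) (weight⇒uniform-act wc))
    (combo-weights-symmetric A q)
  where
  Σ≡2 : Σ6 (weights q) ≡ + 2
  Σ≡2 = trans (Σ6-weights q) (cong (+ 2 *_) (sum≡1 wd))

proposition2p6 : (A : Mat 3 3) →
    BalLe A (+ 2) ⇔
      (RankLt3 (Θ A) × (TernaryVec (rowSum A) × TernaryVec (colSum A) × TernaryVec (diag A)))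
proposition2p6 A = mk⇔ forward backward
  where
  forward : BalLe A (+ 2) → RankLt3 (Θ A) × (TernaryVec (rowSum A) × TernaryVec (colSum A) × TernaryVec (diag A))
  forward (c , 0<Σc , Σc≤2 , E∈IJ) = balanced⇒rank A c balanced Σc≡1∨2 , ternary 𝟐 , ternary 𝟑 , ternary 𝟏
    where
    balanced : ∀ r → Uniform (act c (Θ A r))
    balanced = InIJ⇒uniform-act A c E∈IJ
    Σc≡1∨2 : Σ6 c ≡ + 1 ⊎ Σ6 c ≡ + 2
    Σc≡1∨2 = 0<i≤2⇒i≡1∨i≡2 0<Σc Σc≤2
    ternary : ∀ r → TernaryVec (Θ A r)
    ternary = balanced⇒ternary A c balanced Σc≡1∨2

  backward : RankLt3 (Θ A) × (TernaryVec (rowSum A) × TernaryVec (colSum A) × TernaryVec (diag A)) → BalLe A (+ 2)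
  backward (rank , tr , tc , td) = let q , w = common-weight A rank tr tc td in common-weight⇒balanced A q w
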